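{- Let $m\ge 2$, let $\mathbf{v}=(v_1,\dots,v_m)$ and $\mathbf{k}=(k_1,\dots,k_m)$ be $m$-tuples of positive integers with $k_i\le v_i$ for all $i$ and $k_1\ge 2$, $k_2\ge 2$. Let $X_1,\dots,X_m$ be pairwise disjoint sets with $|X_i|=v_i$ and let $\mathcal{D}$ be a ${\rm GC}(\mathbf{v},\mathbf{k},2)$ on $(X_1,\dots,X_m)$. Let $\mathbf{v}^+=(v_1+v_2,v_3,\dots,v_m)$ and $\mathbf{k}^+=(k_1+k_2,k_3,\dots,k_m)$, and for each block $\mathbf{B}=(B_1,\dots,B_m)\in\mathcal{D}$ let $\mathbf{B}^+=(B_1\cup B_2,B_3,\dots,B_m)$. Then $\mathcal{D}^+=\{\mathbf{B}^+:\mathbf{B}\in\mathcal{D}\}$ (with multiplicity) is a ${\rm GC}(\mathbf{v}^+,\mathbf{k}^+,2)$ on $(X_1\cup X_2,X_3,\dots,X_m)$, and consequently $C(\mathbf{v}^+,\mathbf{k}^+,2)\le C(\mathbf{v},\mathbf{k},2)$.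
   Context: Generalized covering designs: for $p$-tuples of positive integers $\mathbf{v}$, $\mathbf{k}$ with $k_i\le v_i$ and an integer $t$ with $1\le t\le \sum_i k_i$, given pairwise disjoint sets $X_1,\dots,X_p$ with $|X_i|=v_i$, a block is a $p$-tuple $(B_1,\dots,B_p)$ with $B_i\subseteq X_i$, $|B_i|=k_i$. A $p$-tuple of sets $(T_1,\dots,T_p)$ is $(\mathbf{v},\mathbf{k},t)$-admissible if $T_i\subseteq X_i$, $|T_i|\le k_i$ and $\sum_i|T_i|=t$; it is contained in a block if $T_i\subseteq B_i$ for all $i$. A ${\rm GC}(\mathbf{v},\mathbf{k},t)$ is a family of blocks (repetitions allowed) such that every admissible tuple is contained in at least one block, and $C(\mathbf{v},\mathbf{k},t)$ is the minimum number of blocks of a ${\rm GC}(\mathbf{v},\mathbf{k},t)$. -}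

module Defs where

open import Data.Nat using (ℕ; zero; suc; _+_; _≤_)
open import Data.Fin using (Fin; zero; suc)
open import Data.Fin.Subset using (Subset; _⊆_; ∣_∣)
open import Data.Vec using (_++_)
open import Data.List using (List; length; map)
open import Data.List.Membership.Propositional using (_∈_)
open import Data.Product using (Σ; ∃; _×_; _,_; proj₁)
open import Relation.Binary.PropositionalEquality using (_≡_)

sumF : ∀ {m} → (Fin m → ℕ) → ℕ
sumF {zero}  f = 0
sumF {suc m} f = f zero + sumF (λ i → f (suc i))

-- The ground sets X_1,…,X_m are modelled as the (disjoint, since indexed
-- by part) sets Fin (v i); a subset of X_i is a  Subset (v i).

Tuple : ∀ {p} → (Fin p → ℕ) → Set
Tuple {p} v = (i : Fin p) → Subset (v i)

Block : ∀ {p} → (v k : Fin p → ℕ) → Set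
Block v k = Σ (Tuple v) λ B → ∀ i → ∣ B i ∣ ≡ k i

Admissible : ∀ {p} → (v k : Fin p → ℕ) → ℕ → Tuple v → Set
Admissible v k t T = (∀ i → ∣ T i ∣ ≤ k i) × sumF (λ i → ∣ T i ∣) ≡ t

ContainedIn : ∀ {p} {v k : Fin p → ℕ} → Tuple v → Block v k → Set
ContainedIn T B = ∀ i → T i ⊆ proj₁ B i

IsGC : ∀ {p} → (v k : Fin p → ℕ) → ℕ → List (Block v k) → Set
IsGC v k t D = ∀ T → Admissible v k t T → ∃ λ B → B ∈ D × ContainedIn T B

IsCoveringNumber : ∀ {p} → (v k : Fin p → ℕ) → ℕ → ℕ → Set
IsCoveringNumber v k t c =
  (∃ λ D → IsGC v k t D × length D ≡ c) ×
  (∀ D → IsGC v k t D → c ≤ length D)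

-- Merging the first two parts: v⁺ = (v_1 + v_2, v_3, …, v_m).
-- X_1 ∪ X_2 is modelled as Fin (v_1 + v_2), X_1 being the first v_1
-- elements and X_2 the last v_2 elements.
merge : ∀ {n} → (Fin (suc (suc n)) → ℕ) → Fin (suc n) → ℕ
merge v zero    = v zero + v (suc zero)
merge v (suc j) = v (suc (suc j))

mergeTuple : ∀ {n} {v : Fin (suc (suc n)) → ℕ} → Tuple v → Tuple (merge v)
mergeTuple B zero    = B zero ++ B (suc zero)
mergeTuple B (suc j) = B (suc (suc j))

-- A 2-subset of X₁ ∪ X₂ splits into its traces on X₁ and X₂, each of size at
-- most 2 ≤ kᵢ; so a pair admissible for (v⁺, k⁺) comes from a pair admissible
-- for (v, k), and the block of 𝒟 covering the latter merges into a block of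
-- 𝒟⁺ covering the former. Merging is length-preserving, which gives the
-- inequality between covering numbers.
module Submission where

open import Defs
open import Data.Nat using (ℕ; suc; _+_; _≤_)
open import Data.Nat.Properties using (≤-trans; ≤-reflexive; m≤m+n; m≤n+m; +-assoc)
open import Data.Fin using (Fin; zero; suc)
open import Data.Fin.Subset using (Subset; _⊆_; ∣_∣; inside; outside)
open import Data.Fin.Subset.Properties using (drop-∷-⊆)
open import Data.Vec using ([]; _∷_; _++_; take; drop; here; there)
open import Data.Vec.Properties using (take++drop≡id)
open import Data.List using (List; map; length)
open import Data.List.Properties using (length-map; map-∘)
open import Data.List.Membership.Propositional.Properties using (∈-map⁺)
open import Data.Product using (Σ; ∃; _×_; proj₁; _,_)
open import Relation.Binary.PropositionalEquality
  using (_≡_; refl; sym; trans; cong; cong₂; subst; module ≡-Reasoning)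

∣p++q∣≡∣p∣+∣q∣ : ∀ {m n} (p : Subset m) (q : Subset n) → ∣ p ++ q ∣ ≡ ∣ p ∣ + ∣ q ∣
∣p++q∣≡∣p∣+∣q∣ []            q = refl
∣p++q∣≡∣p∣+∣q∣ (inside ∷ p)  q = cong suc (∣p++q∣≡∣p∣+∣q∣ p q)
∣p++q∣≡∣p∣+∣q∣ (outside ∷ p) q = ∣p++q∣≡∣p∣+∣q∣ p q

++-mono-⊆ : ∀ {m n} {p q : Subset m} {r s : Subset n} → p ⊆ q → r ⊆ s → p ++ r ⊆ q ++ s
++-mono-⊆ {p = []}    {[]}    p⊆q r⊆s x∈r           = r⊆s x∈r
++-mono-⊆ {p = _ ∷ _} {_ ∷ _} p⊆q r⊆s here          with p⊆q here
... | here = here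
++-mono-⊆ {p = _ ∷ _} {_ ∷ _} p⊆q r⊆s (there x∈p++r) = there (++-mono-⊆ (drop-∷-⊆ p⊆q) r⊆s x∈p++r)

module _ {n : ℕ} {v k : Fin (suc (suc n)) → ℕ} where

  mergeBlock : Block v k → Block (merge v) (merge k)
  mergeBlock (B , ∣B∣≡k) = mergeTuple B , ∣mergeB∣≡mergek
    where
    ∣mergeB∣≡mergek : ∀ i → ∣ mergeTuple B i ∣ ≡ merge k i
    ∣mergeB∣≡mergek zero    = trans (∣p++q∣≡∣p∣+∣q∣ (B zero) (B (suc zero)))
                                    (cong₂ _+_ (∣B∣≡k zero) (∣B∣≡k (suc zero)))
    ∣mergeB∣≡mergek (suc j) = ∣B∣≡k (suc (suc j))

  splitTuple : Tuple (merge v) → Tuple v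
  splitTuple T zero          = take (v zero) (T zero)
  splitTuple T (suc zero)    = drop (v zero) (T zero)
  splitTuple T (suc (suc j)) = T (suc j)

  mergeTuple-splitTuple : ∀ T i → mergeTuple (splitTuple T) i ≡ T i
  mergeTuple-splitTuple T zero    = take++drop≡id (v zero) (T zero)
  mergeTuple-splitTuple T (suc j) = refl

  ∣splitTuple∣-merge : ∀ T → ∣ splitTuple T zero ∣ + ∣ splitTuple T (suc zero) ∣ ≡ ∣ T zero ∣
  ∣splitTuple∣-merge T = trans (sym (∣p++q∣≡∣p∣+∣q∣ (splitTuple T zero) (splitTuple T (suc zero)))) (cong ∣_∣ (mergeTuple-splitTuple T zero))

  sumF-splitTuple : ∀ T → sumF (λ i → ∣ splitTuple T i ∣) ≡ sumF (λ i → ∣ T i ∣)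
  sumF-splitTuple T = begin
    ∣ T₁ ∣ + (∣ T₂ ∣ + rest) ≡⟨ sym (+-assoc ∣ T₁ ∣ ∣ T₂ ∣ rest) ⟩
    ∣ T₁ ∣ + ∣ T₂ ∣ + rest   ≡⟨ cong (_+ rest) (∣splitTuple∣-merge T) ⟩
    ∣ T zero ∣ + rest        ∎
    where
    open ≡-Reasoning
    T₁ = splitTuple T zero
    T₂ = splitTuple T (suc zero)
    rest = sumF (λ j → ∣ T (suc j) ∣)

  splitTuple-admissible : ∀ {t} → t ≤ k zero → t ≤ k (suc zero) →
    ∀ T → Admissible (merge v) (merge k) t T → Admissible v k t (splitTuple T)
  splitTuple-admissible {t} t≤k₁ t≤k₂ T (∣T∣≤k , ΣT≡t) = ∣splitT∣≤k , trans (sumF-splitTuple T) ΣT≡t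
    where
    ∣T₀∣≤t : ∣ T zero ∣ ≤ t
    ∣T₀∣≤t = subst (∣ T zero ∣ ≤_) ΣT≡t (m≤m+n _ _)
    ∣T₁∣ = ∣ splitTuple T zero ∣
    ∣T₂∣ = ∣ splitTuple T (suc zero) ∣
    ∣splitT∣≤k : ∀ i → ∣ splitTuple T i ∣ ≤ k i
    ∣splitT∣≤k zero          = ≤-trans (subst (∣T₁∣ ≤_) (∣splitTuple∣-merge T) (m≤m+n ∣T₁∣ ∣T₂∣))
                                       (≤-trans ∣T₀∣≤t t≤k₁)
    ∣splitT∣≤k (suc zero)    = ≤-trans (subst (∣T₂∣ ≤_) (∣splitTuple∣-merge T) (m≤n+m ∣T₂∣ ∣T₁∣))
                                       (≤-trans ∣T₀∣≤t t≤k₂)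
    ∣splitT∣≤k (suc (suc j)) = ∣T∣≤k (suc j)

  containedIn-mergeBlock : ∀ T (B : Block v k) →
    ContainedIn (splitTuple T) B → ContainedIn T (mergeBlock B)
  containedIn-mergeBlock T B T⊆B zero    = subst (_⊆ _) (mergeTuple-splitTuple T zero)
                                             (++-mono-⊆ (T⊆B zero) (T⊆B (suc zero)))
  containedIn-mergeBlock T B T⊆B (suc j) = T⊆B (suc (suc j))

  mergeBlock-isGC : ∀ {t} → t ≤ k zero → t ≤ k (suc zero) →
    ∀ D → IsGC v k t D → IsGC (merge v) (merge k) t (map mergeBlock D)
  mergeBlock-isGC t≤k₁ t≤k₂ D gc T adm
    with gc (splitTuple T) (splitTuple-admissible t≤k₁ t≤k₂ T adm)
  ... | B , B∈D , T⊆B = mergeBlock B , ∈-map⁺ mergeBlock B∈D , containedIn-mergeBlock T B T⊆B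

coveringNumber-mono : ∀ {p q} {v k : Fin p → ℕ} {v′ k′ : Fin q → ℕ} {t t′ c c′} →
  (∀ D → IsGC v k t D → ∃ λ D′ → IsGC v′ k′ t′ D′ × length D′ ≤ length D) →
  IsCoveringNumber v k t c → IsCoveringNumber v′ k′ t′ c′ → c′ ≤ c
coveringNumber-mono shrink ((D , gc , ∣D∣≡c) , _) (_ , c′-min) with shrink D gc
... | D′ , gc′ , ∣D′∣≤∣D∣ = subst (_ ≤_) ∣D∣≡c (≤-trans (c′-min D′ gc′) ∣D′∣≤∣D∣)

proposition3p22 :
    (n : ℕ) (v k : Fin (suc (suc n)) → ℕ) →
    (∀ i → 1 ≤ k i) → (∀ i → k i ≤ v i) →
    2 ≤ k zero → 2 ≤ k (suc zero) →
    ((D : List (Block v k)) → IsGC v k 2 D →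
      Σ (List (Block (merge v) (merge k))) λ D⁺ →
        map proj₁ D⁺ ≡ map (λ B → mergeTuple (proj₁ B)) D × IsGC (merge v) (merge k) 2 D⁺)
    × (∀ c c⁺ → IsCoveringNumber v k 2 c → IsCoveringNumber (merge v) (merge k) 2 c⁺ → c⁺ ≤ c)
proposition3p22 n v k _ _ 2≤k₁ 2≤k₂ = merged-isGC , λ _ _ → coveringNumber-mono shrink
  where
  merged-isGC : ∀ D → IsGC v k 2 D → Σ (List (Block (merge v) (merge k))) λ D⁺ →
    map proj₁ D⁺ ≡ map (λ B → mergeTuple (proj₁ B)) D × IsGC (merge v) (merge k) 2 D⁺
  merged-isGC D gc = map mergeBlock D , sym (map-∘ D) , mergeBlock-isGC 2≤k₁ 2≤k₂ D gc

  shrink : ∀ D → IsGC v k 2 D → ∃ λ D⁺ → IsGC (merge v) (merge k) 2 D⁺ × length D⁺ ≤ length D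
  shrink D gc = map mergeBlock D , mergeBlock-isGC 2≤k₁ 2≤k₂ D gc
              , ≤-reflexive (length-map mergeBlock D)
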